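{- Let $\mathcal H=(V,E)$ be an $r$-uniform hypergraph with $\chi(\mathcal H)=d+1$, where $d\ge 1$. Fix $m\in\mathbb N$ and let $\mathcal G\in\mathcal A(\mathcal H,m)$. Then for any coloring of the vertices of $\mathcal G$ into $d$ colors there exist pairwise disjoint vertex sets $W_1,\dots,W_r$ of $\mathcal G$, each of size $\lceil m/d\rceil$, such that every set $\{w_1,\dots,w_r\}$ with $w_j\in W_j$ is an edge of $\mathcal G$ (i.e. $\mathcal G$ contains a copy of $K^r[\lceil m/d\rceil]$), and all vertices of $W_1\cup\dots\cup W_r$ have the same color. Moreover, for any $0<p<1$, $$\Pr[\chi(\mathcal G(p))\le d]\le |E|\binom{m}{\lceil m/d\rceil}^r(1-p)^{\lceil m/d\rceil^r}.$$
   Context: For an $r$-uniform hypergraph $\mathcal H=(V,E)$ and $m\in\mathbb N$, the $m$-blow-up $\mathcal H[m]=(V',E')$ has $V'=V\times[m]$ and $E'=\{\{(v_1,i_1),\dots,(v_r,i_r)\}:\{v_1,\dots,v_r\}\in E,\ i_1,\dots,i_r\in[m]\}$. Let $\mathcal F$ be the class of functions $f:V'\to[N]$ (for some $N$) such that: (1) for every $v\in V$ and $i\ne j$, $f((v,i))\ne f((v,j))$; (2) for every $e\in E'$ and distinct $x,y\in e$, $f(x)\ne f(y)$; (3) $f$ is surjective. Then $\mathcal A(\mathcal H,m)$ is the class of hypergraphs $(f(V'),E_f)$ with $f\in\mathcal F$ and $E_f=\{\{f(x_1),\dots,f(x_r)\}:\{x_1,\dots,x_r\}\in E'\}$. $K^r[t]$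 denotes the complete $r$-partite $r$-uniform hypergraph with parts of size $t$. $\chi$ denotes the chromatic number (least number of colors in a vertex coloring with no monochromatic edge). For $p\in(0,1)$, $\mathcal G(p)$ is the random hypergraph on the vertex set of $\mathcal G$ containing each edge of $\mathcal G$ independently with probability $p$.
   Formalization: The edge probability p in the bound on the probability that G(p) is d-colorable takes only rational values with $0<p<1$. -}

module Defs where

open import Data.Nat using (ℕ; zero; suc; NonZero; _∸_)
import Data.Nat as ℕ
open import Data.Nat.DivMod using (_/_)
open import Data.Fin using (Fin)
open import Data.Fin.Subset using (Subset; _∈_; ∣_∣; ⊤)
open import Data.List using (List; []; _∷_; length)
import Data.List.Membership.Propositional as LM
open import Data.List.Relation.Unary.All using (All)
open import Data.List.Relation.Unary.Unique.Propositional using (Unique)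
open import Data.Product using (Σ; ∃; _×_)
open import Data.Empty using (⊥)
open import Data.Integer using (+_)
open import Data.Rational using (ℚ; 1ℚ; 0ℚ; _*_; _+_; _-_)
import Data.Rational as ℚ
open import Relation.Nullary using (¬_; Dec; does)
open import Relation.Binary.PropositionalEquality using (_≡_; _≢_)
open import Function.Bundles using (_⇔_)

record Hypergraph (r : ℕ) : Set where
  field
    n        : ℕ
    edges    : List (Subset n)
    uniform  : All (λ e → ∣ e ∣ ≡ r) edges
    distinct : Unique edges
open Hypergraph public

Mono : ∀ {n k} → (Fin n → Fin k) → Subset n → Set
Mono c e = ∀ u v → u ∈ e → v ∈ e → c u ≡ c v

ProperFor : ∀ {n k} → (Fin n → Fin k) → List (Subset n) → Set
ProperFor c es = ∀ e → e LM.∈ es → ¬ Mono c e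

ColorableEdges : (n : ℕ) → List (Subset n) → ℕ → Set
ColorableEdges n es k = Σ (Fin n → Fin k) λ c → ProperFor c es

Colorable : ∀ {r} → Hypergraph r → ℕ → Set
Colorable H k = ColorableEdges (n H) (edges H) k

ChromaticNumber : ∀ {r} → Hypergraph r → ℕ → Set
ChromaticNumber H k = Colorable H k × (∀ j → j ℕ.< k → ¬ Colorable H j)

IsImage : ∀ {a b} → (Fin a → Fin b) → Subset a → Subset b → Set
IsImage h e S = ∀ x → (x ∈ S) ⇔ (∃ λ v → v ∈ e × h v ≡ x)

-- G ∈ 𝒜(H, m): G is (the image of) the m-blow-up H[m] under some f ∈ ℱ.
-- A vertex (v,i) of V × [m] is encoded as  v : Fin (n H), i : Fin m,
-- and [N] is the vertex set Fin (n G) of G.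
-- An edge of H[m] is {(v, g v) : v ∈ e} for e ∈ E and a choice g of indices.
InA : ∀ {r} → Hypergraph r → ℕ → Hypergraph r → Set
InA H m G =
  Σ (Fin (n H) → Fin m → Fin (n G)) λ f →
    (∀ v i j → i ≢ j → f v i ≢ f v j)
    -- (2) distinct vertices of an edge of H[m] get distinct labels
  × (∀ e → e LM.∈ edges H → ∀ (g : Fin (n H) → Fin m) → ∀ u v →
        u ∈ e → v ∈ e → u ≢ v → f u (g u) ≢ f v (g v))
  × (∀ y → ∃ λ v → ∃ λ i → f v i ≡ y)
  × (∀ S → (S LM.∈ edges G) ⇔
        (∃ λ e → e LM.∈ edges H × ∃ λ (g : Fin (n H) → Fin m) →
           IsImage (λ v → f v (g v)) e S))

⌈_/_⌉ : ℕ → (d : ℕ) → .{{NonZero d}} → ℕ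
⌈ m / d ⌉ = (m ℕ.+ (d ∸ 1)) / d

_^ℚ_ : ℚ → ℕ → ℚ
q ^ℚ zero  = 1ℚ
q ^ℚ suc k = q * (q ^ℚ k)

ℕtoℚ : ℕ → ℚ
ℕtoℚ k = (+ k) ℚ./ 1

-- Probability, in the model where each edge of the list es is kept
-- independently with probability p, that the set of kept edges satisfies
-- P (given together with a decision procedure). `kept` accumulates the
-- already-kept edges; start it at [].
probKept : ∀ {A : Set} {P : List A → Set} → ℚ → ((S : List A) → Dec (P S)) →
           List A → List A → ℚ
probKept p P? kept []       = if does (P? kept) then 1ℚ else 0ℚ
  where open import Data.Bool using (if_then_else_)
probKept p P? kept (e ∷ es) =
  p * probKept p P? (e ∷ kept) es + (1ℚ - p) * probKept p P? kept es

-- Given a d-coloring c of G, color each vertex v of H by a color that c uses on at least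
-- ⌈m/d⌉ of the m labels f v i (pigeonhole).  As χ(H) > d, some edge e of H is monochromatic
-- for this coloring, and the chosen labels of the vertices of e span a monochromatic
-- K^r[⌈m/d⌉] in G: condition (2) on f makes the parts disjoint, and every transversal is the
-- image of an edge of H[m].
-- Consequently a d-colorable G(p) misses all ⌈m/d⌉^r edges of one of the |E| (m choose ⌈m/d⌉)^r
-- such copies (one for each edge of H and each choice of ⌈m/d⌉ labels at each of its vertices),
-- and a union bound over these copies gives the probability estimate.

module Submission where

module UniqueLists where

  open import Data.Nat using (_≤_)
  open import Data.Fin using (Fin; zero; suc)
  open import Data.Fin.Properties using (injective⇒≤)
  open import Data.List using (List; _∷_; length; lookup)
  open import Data.List.Membership.Propositional.Properties using (∈-lookup)
  open import Data.List.Relation.Binary.Subset.Propositional using (_⊆_)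
  import Data.List.Relation.Unary.Any as Any
  open import Data.List.Relation.Unary.Any.Properties using (lookup-index)
  import Data.List.Relation.Unary.All as All
  open import Data.List.Relation.Unary.AllPairs using (_∷_)
  open import Data.List.Relation.Unary.Unique.Propositional using (Unique)
  open import Data.Empty using (⊥-elim)
  open import Function.Definitions using (Injective)
  open import Relation.Binary.PropositionalEquality using (_≡_; refl; sym; cong; module ≡-Reasoning)

  module _ {A : Set} where

    Unique⇒lookup-injective : ∀ {xs : List A} → Unique xs → Injective _≡_ _≡_ (lookup xs)
    Unique⇒lookup-injective {x ∷ xs} (x∉ ∷ xs!) {zero}  {zero}  eq = refl
    Unique⇒lookup-injective {x ∷ xs} (x∉ ∷ xs!) {zero}  {suc j} eq = ⊥-elim (All.lookup x∉ (∈-lookup j) eq)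
    Unique⇒lookup-injective {x ∷ xs} (x∉ ∷ xs!) {suc i} {zero}  eq = ⊥-elim (All.lookup x∉ (∈-lookup i) (sym eq))
    Unique⇒lookup-injective {x ∷ xs} (x∉ ∷ xs!) {suc i} {suc j} eq = cong suc (Unique⇒lookup-injective xs! eq)

    Unique-⊆⇒length≤ : ∀ {xs ys : List A} → Unique xs → xs ⊆ ys → length xs ≤ length ys
    Unique-⊆⇒length≤ {xs} {ys} xs! xs⊆ys = injective⇒≤ position-injective
      where
      position : Fin (length xs) → Fin (length ys)
      position i = Any.index (xs⊆ys (∈-lookup i))

      lookup-position : ∀ i → lookup xs i ≡ lookup ys (position i)
      lookup-position i = lookup-index (xs⊆ys (∈-lookup i))

      position-injective : Injective _≡_ _≡_ position
      position-injective {i} {j} eq = Unique⇒lookup-injective xs! (begin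
        lookup xs i             ≡⟨ lookup-position i ⟩
        lookup ys (position i)  ≡⟨ cong (lookup ys) eq ⟩
        lookup ys (position j)  ≡⟨ lookup-position j ⟨
        lookup xs j             ∎)
        where open ≡-Reasoning

module Choices where

  open import Data.Nat using (zero; suc; _*_; _+_; _^_)
  open import Data.Fin using (Fin; zero; suc)
  open import Data.Vec using (Vec; []; _∷_; lookup; tabulate)
  open import Data.Vec.Properties using (∷-injective; tabulate∘lookup; tabulate-cong)
  open import Data.List using (List; []; _∷_; [_]; length; map; _++_; cartesianProductWith)
  open import Data.List.Properties using (length-map; length-++)
  open import Data.List.Membership.Propositional using (_∈_)
  open import Data.List.Membership.Propositional.Properties
    using (∈-cartesianProductWith⁺; ∈-cartesianProductWith⁻)
  open import Data.List.Relation.Unary.Any using (here)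
  open import Data.List.Relation.Unary.AllPairs using ([]; _∷_)
  import Data.List.Relation.Unary.All as All
  open import Data.List.Relation.Unary.Unique.Propositional using (Unique)
  import Data.List.Relation.Unary.Unique.Propositional.Properties as Unique
  open import Data.Product using (_,_)
  open import Relation.Binary.PropositionalEquality using (_≡_; refl; cong₂; module ≡-Reasoning)

  length-cartesianProductWith : ∀ {A B C : Set} (f : A → B → C) xs ys →
    length (cartesianProductWith f xs ys) ≡ length xs * length ys
  length-cartesianProductWith f []       ys = refl
  length-cartesianProductWith f (x ∷ xs) ys = begin
    length (map (f x) ys ++ cartesianProductWith f xs ys)
      ≡⟨ length-++ (map (f x) ys) ⟩
    length (map (f x) ys) + length (cartesianProductWith f xs ys)
      ≡⟨ cong₂ _+_ (length-map (f x) ys) (length-cartesianProductWith f xs ys) ⟩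
    length ys + length xs * length ys ∎
    where open ≡-Reasoning

  module _ {A : Set} where

    choices : ∀ {r} → (Fin r → List A) → List (Vec A r)
    choices {zero}  xss = [ [] ]
    choices {suc r} xss = cartesianProductWith _∷_ (xss zero) (choices (λ j → xss (suc j)))

    length-choices : ∀ {r k} (xss : Fin r → List A) → (∀ j → length (xss j) ≡ k) →
                     length (choices xss) ≡ k ^ r
    length-choices {zero}      xss len = refl
    length-choices {suc r} {k} xss len = begin
      length (choices xss)
        ≡⟨ length-cartesianProductWith _∷_ (xss zero) _ ⟩
      length (xss zero) * length (choices (λ j → xss (suc j)))
        ≡⟨ cong₂ _*_ (len zero) (length-choices (λ j → xss (suc j)) (λ j → len (suc j))) ⟩
      k * k ^ r ∎
      where open ≡-Reasoning

    ∈-choices⁺ : ∀ {r} (xss : Fin r → List A) {v : Vec A r} → (∀ j → lookup v j ∈ xss j) → v ∈ choices xss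
    ∈-choices⁺ {zero}  xss {[]}    v∈ = here refl
    ∈-choices⁺ {suc r} xss {x ∷ v} v∈ =
      ∈-cartesianProductWith⁺ _∷_ (v∈ zero) (∈-choices⁺ (λ j → xss (suc j)) (λ j → v∈ (suc j)))

    ∈-choices⁻ : ∀ {r} (xss : Fin r → List A) {v : Vec A r} → v ∈ choices xss → ∀ j → lookup v j ∈ xss j
    ∈-choices⁻ {suc r} xss v∈ j with ∈-cartesianProductWith⁻ _∷_ (xss zero) (choices (λ j → xss (suc j))) v∈
    ∈-choices⁻ {suc r} xss v∈ zero    | x , v , x∈ , v∈′ , refl = x∈
    ∈-choices⁻ {suc r} xss v∈ (suc j) | x , v , x∈ , v∈′ , refl = ∈-choices⁻ (λ j → xss (suc j)) v∈′ j

    choices-Unique : ∀ {r} (xss : Fin r → List A) → (∀ j → Unique (xss j)) → Unique (choices xss)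
    choices-Unique {zero}  xss xss! = All.[] ∷ []
    choices-Unique {suc r} xss xss! = Unique.cartesianProductWith⁺ _∷_ ∷-injective
      (xss! zero) (choices-Unique (λ j → xss (suc j)) (λ j → xss! (suc j)))

    lookup-injective : ∀ {r} {xs ys : Vec A r} → (∀ j → lookup xs j ≡ lookup ys j) → xs ≡ ys
    lookup-injective {xs = xs} {ys} xs≗ys = begin
      xs                    ≡⟨ tabulate∘lookup xs ⟨
      tabulate (lookup xs)  ≡⟨ tabulate-cong xs≗ys ⟩
      tabulate (lookup ys)  ≡⟨ tabulate∘lookup ys ⟩
      ys                    ∎
      where open ≡-Reasoning

module FiniteSubsets where

  open import Data.Nat using (ℕ; zero; suc; _+_; _≤_; s≤s)
  open import Data.Nat.Properties using (≤-antisym; suc-injective)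
  open import Data.Nat.Combinatorics using (_C_; nCk+nC[k+1]≡[n+1]C[k+1])
  open import Data.Fin using (Fin; zero; suc)
  open import Data.Fin.Properties using (any?; _≟_)
  import Data.Fin.Properties as Fin
  open import Data.Fin.Subset using (Subset; inside; outside; _∈_; _⊆_; ∣_∣; ⊥)
  open import Data.Fin.Subset.Properties using (_∈?_; ∉⊥; ∣⊥∣≡0)
  open import Data.Vec using ([]; _∷_; here; there; tabulate)
  open import Data.Vec.Properties using ([]=⇒lookup; lookup⇒[]=; lookup∘tabulate)
  open import Data.List using (List; []; _∷_; [_]; length; map; _++_; lookup)
  open import Data.List.Properties using (length-map; length-++)
  import Data.List.Membership.Propositional as List
  open import Data.List.Membership.Propositional.Properties
    using (∈-map⁺; ∈-map⁻; ∈-++⁺ˡ; ∈-++⁺ʳ; ∈-++⁻; ∈-lookup)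
  open import Data.List.Relation.Unary.Any using (here; there; index)
  open import Data.List.Relation.Unary.Any.Properties using (lookup-index)
  import Data.List.Relation.Unary.All as All
  open import Data.List.Relation.Unary.AllPairs using ([]; _∷_)
  open import Data.List.Relation.Unary.Unique.Propositional using (Unique)
  import Data.List.Relation.Unary.Unique.Propositional.Properties as Unique
  open import Data.Product using (∃; _×_; _,_)
  open import Data.Sum using (inj₁; inj₂)
  open import Data.Empty using (⊥-elim)
  open import Function using (mk⇔)
  open import Function.Definitions using (Injective)
  open import Relation.Nullary using (Dec; yes; does)
  open import Relation.Nullary.Decidable using (dec-true; _×-dec_)
  open import Level using (0ℓ)
  open import Relation.Unary using (Pred; Decidable)
  open import Relation.Binary.PropositionalEquality
    using (_≡_; _≢_; refl; sym; trans; cong; cong₂; subst; module ≡-Reasoning)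
  open import Defs using (IsImage)
  open UniqueLists

  elements : ∀ {n} → Subset n → List (Fin n)
  elements []            = []
  elements (inside ∷ s)  = zero ∷ map suc (elements s)
  elements (outside ∷ s) = map suc (elements s)

  length-elements : ∀ {n} (s : Subset n) → length (elements s) ≡ ∣ s ∣
  length-elements []            = refl
  length-elements (inside ∷ s)  = cong suc (trans (length-map suc (elements s)) (length-elements s))
  length-elements (outside ∷ s) = trans (length-map suc (elements s)) (length-elements s)

  ∈-elements⁺ : ∀ {n} {s : Subset n} {x} → x ∈ s → x List.∈ elements s
  ∈-elements⁺ {s = inside ∷ s}  here       = here refl
  ∈-elements⁺ {s = inside ∷ s}  (there x∈) = there (∈-map⁺ suc (∈-elements⁺ x∈))
  ∈-elements⁺ {s = outside ∷ s} (there x∈) = ∈-map⁺ suc (∈-elements⁺ x∈)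

  ∈-elements⁻ : ∀ {n} {s : Subset n} {x} → x List.∈ elements s → x ∈ s
  ∈-elements⁻ {s = inside ∷ s} (here refl) = here
  ∈-elements⁻ {s = inside ∷ s} (there x∈) with ∈-map⁻ suc x∈
  ... | y , y∈ , refl = there (∈-elements⁻ y∈)
  ∈-elements⁻ {s = outside ∷ s} x∈ with ∈-map⁻ suc x∈
  ... | y , y∈ , refl = there (∈-elements⁻ y∈)

  elements-Unique : ∀ {n} (s : Subset n) → Unique (elements s)
  elements-Unique []            = []
  elements-Unique (inside ∷ s)  =
    All.tabulate zero∉ ∷ Unique.map⁺ Fin.suc-injective (elements-Unique s)
    where
    zero∉ : ∀ {x} → x List.∈ map suc (elements s) → zero ≢ x
    zero∉ x∈ refl with ∈-map⁻ suc x∈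
    ... | _ , _ , ()
  elements-Unique (outside ∷ s) = Unique.map⁺ Fin.suc-injective (elements-Unique s)

  module _ {n} {P : Pred (Fin n) 0ℓ} (P? : Decidable P) where

    subsetOf : Subset n
    subsetOf = tabulate (λ x → does (P? x))

    ∈-subsetOf⁺ : ∀ {x} → P x → x ∈ subsetOf
    ∈-subsetOf⁺ {x} px = lookup⇒[]= x _ (trans (lookup∘tabulate _ x) (dec-true (P? x) px))

    ∈-subsetOf⁻ : ∀ {x} → x ∈ subsetOf → P x
    ∈-subsetOf⁻ {x} x∈ with P? x | trans (sym (lookup∘tabulate _ x)) ([]=⇒lookup x∈)
    ... | yes px | _ = px

  module _ {a b} (h : Fin a → Fin b) where

    hit? : ∀ s y → Dec (∃ λ x → x ∈ s × h x ≡ y)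
    hit? s y = any? (λ x → (x ∈? s) ×-dec (h x ≟ y))

    image : Subset a → Subset b
    image s = subsetOf (hit? s)

    ∈-image⁺ : ∀ {s x} → x ∈ s → h x ∈ image s
    ∈-image⁺ {s} x∈ = ∈-subsetOf⁺ (hit? s) (_ , x∈ , refl)

    ∈-image⁻ : ∀ {s y} → y ∈ image s → ∃ λ x → x ∈ s × h x ≡ y
    ∈-image⁻ {s} = ∈-subsetOf⁻ (hit? s)

    ∣image∣≡∣s∣ : Injective _≡_ _≡_ h → ∀ s → ∣ image s ∣ ≡ ∣ s ∣
    ∣image∣≡∣s∣ h-inj s = begin
      ∣ image s ∣                   ≡⟨ length-elements (image s) ⟨
      length (elements (image s))   ≡⟨ ≤-antisym image≤ image≥ ⟩
      length (map h (elements s))   ≡⟨ length-map h (elements s) ⟩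
      length (elements s)           ≡⟨ length-elements s ⟩
      ∣ s ∣                         ∎
      where
      open ≡-Reasoning
      image≤ : length (elements (image s)) ≤ length (map h (elements s))
      image≤ = Unique-⊆⇒length≤ (elements-Unique (image s)) λ y∈ →
        let x , x∈ , hx≡y = ∈-image⁻ (∈-elements⁻ y∈) in
        subst (List._∈ _) hx≡y (∈-map⁺ h (∈-elements⁺ x∈))
      image≥ : length (map h (elements s)) ≤ length (elements (image s))
      image≥ = Unique-⊆⇒length≤ (Unique.map⁺ h-inj (elements-Unique s)) λ y∈ →
        let x , x∈ , hx≡y = ∈-map⁻ h y∈ in
        subst (List._∈ _) (sym hx≡y) (∈-elements⁺ (∈-image⁺ (∈-elements⁻ x∈)))

    IsImage-image : ∀ {h′} → (∀ x → h x ≡ h′ x) → ∀ s → IsImage h′ s (image s)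
    IsImage-image {h′} h≗h′ s y = mk⇔
      (λ y∈ → let x , x∈ , hx≡y = ∈-image⁻ y∈ in x , x∈ , trans (sym (h≗h′ x)) hx≡y)
      (λ (x , x∈ , h′x≡y) → subst (_∈ image s) (trans (h≗h′ x) h′x≡y) (∈-image⁺ x∈))

  record Enumeration {n} (s : Subset n) (k : ℕ) : Set where
    field
      at         : Fin k → Fin n
      injective  : Injective _≡_ _≡_ at
      at∈        : ∀ j → at j ∈ s
      surjective : ∀ {x} → x ∈ s → ∃ λ j → at j ≡ x

  enumeration : ∀ {n k} (s : Subset n) → ∣ s ∣ ≡ k → Enumeration s k
  enumeration s refl = enumerate (length-elements s)
    where
    enumerate : ∀ {k} → length (elements s) ≡ k → Enumeration s k
    enumerate refl = record
      { at         = lookup (elements s)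
      ; injective  = Unique⇒lookup-injective (elements-Unique s)
      ; at∈        = λ j → ∈-elements⁻ (∈-lookup j)
      ; surjective = λ x∈ → let x∈ᴸ = ∈-elements⁺ x∈ in index x∈ᴸ , sym (lookup-index x∈ᴸ)
      }

  ⊆-of-size : ∀ {n} k (t : Subset n) → k ≤ ∣ t ∣ → ∃ λ s → s ⊆ t × ∣ s ∣ ≡ k
  ⊆-of-size {n} zero t _ = ⊥ , (λ x∈ → ⊥-elim (∉⊥ x∈)) , ∣⊥∣≡0 n
  ⊆-of-size (suc k) (inside ∷ t) (s≤s k≤) with ⊆-of-size k t k≤
  ... | s , s⊆t , ∣s∣≡k = inside ∷ s , (λ { here → here ; (there x∈) → there (s⊆t x∈) }) , cong suc ∣s∣≡k
  ⊆-of-size (suc k) (outside ∷ t) k≤ with ⊆-of-size (suc k) t k≤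
  ... | s , s⊆t , ∣s∣≡k = outside ∷ s , (λ { (there x∈) → there (s⊆t x∈) }) , ∣s∣≡k

  subsetsOfSize : ∀ m → ℕ → List (Subset m)
  subsetsOfSize zero    zero    = [ [] ]
  subsetsOfSize zero    (suc k) = []
  subsetsOfSize (suc m) zero    = map (outside ∷_) (subsetsOfSize m zero)
  subsetsOfSize (suc m) (suc k) =
    map (inside ∷_) (subsetsOfSize m k) ++ map (outside ∷_) (subsetsOfSize m (suc k))

  length-subsetsOfSize : ∀ m k → length (subsetsOfSize m k) ≡ m C k
  length-subsetsOfSize zero    zero    = refl
  length-subsetsOfSize zero    (suc k) = refl
  length-subsetsOfSize (suc m) zero    =
    trans (length-map (outside ∷_) (subsetsOfSize m zero)) (length-subsetsOfSize m zero)
  length-subsetsOfSize (suc m) (suc k) = begin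
    length (map (inside ∷_) (subsetsOfSize m k) ++ map (outside ∷_) (subsetsOfSize m (suc k)))
      ≡⟨ length-++ (map (inside ∷_) (subsetsOfSize m k)) ⟩
    length (map (inside ∷_) (subsetsOfSize m k)) + length (map (outside ∷_) (subsetsOfSize m (suc k)))
      ≡⟨ cong₂ _+_ (trans (length-map _ (subsetsOfSize m k)) (length-subsetsOfSize m k))
                   (trans (length-map _ (subsetsOfSize m (suc k))) (length-subsetsOfSize m (suc k))) ⟩
    m C k + m C suc k
      ≡⟨ nCk+nC[k+1]≡[n+1]C[k+1] m k ⟩
    suc m C suc k ∎
    where open ≡-Reasoning

  ∈-subsetsOfSize⁺ : ∀ m k {s : Subset m} → ∣ s ∣ ≡ k → s List.∈ subsetsOfSize m k
  ∈-subsetsOfSize⁺ zero    zero    {[]}          _   = here refl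
  ∈-subsetsOfSize⁺ (suc m) zero    {outside ∷ s} eq  = ∈-map⁺ (outside ∷_) (∈-subsetsOfSize⁺ m zero eq)
  ∈-subsetsOfSize⁺ (suc m) (suc k) {inside ∷ s}  eq  =
    ∈-++⁺ˡ (∈-map⁺ (inside ∷_) (∈-subsetsOfSize⁺ m k (suc-injective eq)))
  ∈-subsetsOfSize⁺ (suc m) (suc k) {outside ∷ s} eq  =
    ∈-++⁺ʳ _ (∈-map⁺ (outside ∷_) (∈-subsetsOfSize⁺ m (suc k) eq))

  ∈-subsetsOfSize⁻ : ∀ m k {s : Subset m} → s List.∈ subsetsOfSize m k → ∣ s ∣ ≡ k
  ∈-subsetsOfSize⁻ zero    zero    (here refl) = refl
  ∈-subsetsOfSize⁻ (suc m) zero    s∈ with ∈-map⁻ (outside ∷_) s∈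
  ... | t , t∈ , refl = ∈-subsetsOfSize⁻ m zero t∈
  ∈-subsetsOfSize⁻ (suc m) (suc k) s∈ with ∈-++⁻ (map (inside ∷_) (subsetsOfSize m k)) s∈
  ... | inj₁ s∈ᵢ with ∈-map⁻ (inside ∷_) s∈ᵢ
  ...   | t , t∈ , refl = cong suc (∈-subsetsOfSize⁻ m k t∈)
  ∈-subsetsOfSize⁻ (suc m) (suc k) s∈ | inj₂ s∈ₒ with ∈-map⁻ (outside ∷_) s∈ₒ
  ...   | t , t∈ , refl = ∈-subsetsOfSize⁻ m (suc k) t∈

module FinFunctions where

  open import Data.Fin using (Fin)
  open import Data.Fin.Properties using (any?; _≟_)
  open import Data.Product using (∃; _×_; _,_)
  open import Data.Empty using (⊥-elim)
  open import Function.Definitions using (Injective)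
  open import Relation.Nullary using (yes; no)
  open import Relation.Binary.PropositionalEquality using (_≡_; _≢_; refl; sym; cong)

  two-point : ∀ {a b} {u v : Fin a} → u ≢ v → (x y : Fin b) →
              ∃ λ (g : Fin a → Fin b) → g u ≡ x × g v ≡ y
  two-point {u = u} {v} u≢v x y = g , gu≡x , gv≡y
    where
    g : Fin _ → Fin _
    g w with w ≟ u
    ... | yes _ = x
    ... | no _  = y
    gu≡x : g u ≡ x
    gu≡x with u ≟ u
    ... | yes _   = refl
    ... | no u≢u = ⊥-elim (u≢u refl)
    gv≡y : g v ≡ y
    gv≡y with v ≟ u
    ... | yes v≡u = ⊥-elim (u≢v (sym v≡u))
    ... | no _    = refl

  extend : ∀ {k a b} {U : Fin k → Fin a} → Injective _≡_ _≡_ U → Fin b → (x : Fin k → Fin b) →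
           ∃ λ (g : Fin a → Fin b) → ∀ j → g (U j) ≡ x j
  extend {U = U} U-inj default x = g , g∘U≡x
    where
    g : Fin _ → Fin _
    g w with any? (λ j → U j ≟ w)
    ... | yes (j , _) = x j
    ... | no _        = default
    g∘U≡x : ∀ j → g (U j) ≡ x j
    g∘U≡x j with any? (λ j′ → U j′ ≟ U j)
    ... | yes (j′ , U[j′]≡U[j]) = cong x (U-inj U[j′]≡U[j])
    ... | no ¬∃j′              = ⊥-elim (¬∃j′ (j , refl))

module Fibres where

  open import Data.Nat using (ℕ; zero; suc; _+_; _*_; _≤_; _<_; _≤?_; NonZero; >-nonZero⁻¹; s≤s⁻¹; z≤n)
  open import Data.Nat.Properties using
    ( +-*-semiring; +-mono-≤; +-monoˡ-≤; +-cancelʳ-≤; +-comm; *-comm; *-identityʳ; *-zeroʳ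
    ; <⇒≱; ≰⇒>; n<1+n; module ≤-Reasoning )
  open import Data.Nat.DivMod using (_/_; m<n*o⇒m/o<n)
  open import Data.Bool using (true; false; if_then_else_)
  open import Data.Fin using (Fin; zero; suc)
  open import Data.Fin.Properties using (any?; _≟_)
  open import Data.Fin.Subset using (Subset; _∈_; ∣_∣)
  open import Data.Vec using (_∷_)
  open import Data.Product using (∃; _,_)
  open import Function using (_⟨_⟩_)
  open import Relation.Nullary using (yes; no; does; contradiction)
  open import Relation.Binary.PropositionalEquality
    using (_≡_; refl; sym; trans; cong; cong₂; subst; module ≡-Reasoning)
  open import Algebra.Properties.Semiring.Sum +-*-semiring
    using (sum; sum-syntax; sum-cong-≗; ∑-distrib-+; *-distribˡ-sum)
  open import Defs using (⌈_/_⌉)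
  open FiniteSubsets

  sum-const : ∀ n c → ∑[ i < n ] c ≡ n * c
  sum-const zero    c = refl
  sum-const (suc n) c = cong (c +_) (sum-const n c)

  sum-mono-≤ : ∀ {n} {f g : Fin n → ℕ} → (∀ i → f i ≤ g i) → sum f ≤ sum g
  sum-mono-≤ {zero}  f≤g = z≤n
  sum-mono-≤ {suc n} f≤g = +-mono-≤ (f≤g zero) (sum-mono-≤ (λ i → f≤g (suc i)))

  averaging : ∀ d .{{_ : NonZero d}} (a : Fin d → ℕ) → ∃ λ i → sum a ≤ d * a i
  averaging d a with any? (λ i → sum a ≤? d * a i)
  ... | yes large = large
  ... | no ¬large = contradiction (+-cancelʳ-≤ (d * sum a) d 0 too-large) (<⇒≱ (>-nonZero⁻¹ d))
    where
    open ≤-Reasoning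
    too-large : d + d * sum a ≤ 0 + d * sum a
    too-large = begin
      d + d * sum a                        ≡⟨ cong₂ _+_ (sym (*-identityʳ d)) (*-distribˡ-sum d a) ⟩
      d * 1 + ∑[ i < d ] (d * a i)         ≡⟨ cong (_+ ∑[ i < d ] (d * a i)) (sym (sum-const d 1)) ⟩
      ∑[ i < d ] 1 + ∑[ i < d ] (d * a i)  ≡⟨ sym (∑-distrib-+ (λ _ → 1) (λ i → d * a i)) ⟩
      ∑[ i < d ] suc (d * a i)             ≤⟨ sum-mono-≤ (λ i → ≰⇒> (λ le → ¬large (i , le))) ⟩
      ∑[ i < d ] sum a                     ≡⟨ sum-const d (sum a) ⟩
      d * sum a                            ∎

  m≤d*a⇒⌈m/d⌉≤a : ∀ {m} d .{{_ : NonZero d}} {a} → m ≤ d * a → ⌈ m / d ⌉ ≤ a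
  m≤d*a⇒⌈m/d⌉≤a {m} d@(suc d′) {a} m≤d*a = s≤s⁻¹ (m<n*o⇒m/o<n (begin-strict
    m + d′      ≤⟨ +-monoˡ-≤ d′ m≤d*a ⟩
    d * a + d′  ≡⟨ cong (_+ d′) (*-comm d a) ⟩
    a * d + d′  ≡⟨ +-comm (a * d) d′ ⟩
    d′ + a * d  <⟨ n<1+n (d′ + a * d) ⟩
    suc a * d   ∎))
    where open ≤-Reasoning

  fibre : ∀ {m d} → (Fin m → Fin d) → Fin d → Subset m
  fibre φ c = subsetOf (λ i → φ i ≟ c)

  ∈-fibre⁻ : ∀ {m d} (φ : Fin m → Fin d) {c i} → i ∈ fibre φ c → φ i ≡ c
  ∈-fibre⁻ φ {c} = ∈-subsetOf⁻ (λ i → φ i ≟ c)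

  ∑-indicator≡1 : ∀ {d} (x : Fin d) → ∑[ c < d ] (if does (x ≟ c) then 1 else 0) ≡ 1
  ∑-indicator≡1 {suc d} zero    = cong suc (sum-const d 0 ⟨ trans ⟩ *-zeroʳ d)
  ∑-indicator≡1 {suc d} (suc x) = ∑-indicator≡1 {d} x

  ∣x∷p∣≡[x]+∣p∣ : ∀ {m} b (t : Subset m) → ∣ b ∷ t ∣ ≡ (if b then 1 else 0) + ∣ t ∣
  ∣x∷p∣≡[x]+∣p∣ true  t = refl
  ∣x∷p∣≡[x]+∣p∣ false t = refl

  ∑-∣fibre∣ : ∀ {m d} (φ : Fin m → Fin d) → ∑[ c < d ] ∣ fibre φ c ∣ ≡ m
  ∑-∣fibre∣ {zero}  {d} φ = sum-const d 0 ⟨ trans ⟩ *-zeroʳ d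
  ∑-∣fibre∣ {suc m} {d} φ = begin
    ∑[ c < d ] ∣ fibre φ c ∣
      ≡⟨ sum-cong-≗ (λ c → ∣x∷p∣≡[x]+∣p∣ (does (φ zero ≟ c)) (fibre (λ i → φ (suc i)) c)) ⟩
    ∑[ c < d ] ((if does (φ zero ≟ c) then 1 else 0) + ∣ fibre (λ i → φ (suc i)) c ∣)
      ≡⟨ ∑-distrib-+ (λ c → if does (φ zero ≟ c) then 1 else 0) (λ c → ∣ fibre (λ i → φ (suc i)) c ∣) ⟩
    ∑[ c < d ] (if does (φ zero ≟ c) then 1 else 0) + ∑[ c < d ] ∣ fibre (λ i → φ (suc i)) c ∣
      ≡⟨ cong₂ _+_ (∑-indicator≡1 (φ zero)) (∑-∣fibre∣ (λ i → φ (suc i))) ⟩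
    suc m ∎
    where open ≡-Reasoning

  pigeonhole-⌈/⌉ : ∀ {m} d .{{_ : NonZero d}} (φ : Fin m → Fin d) → ∃ λ c → ⌈ m / d ⌉ ≤ ∣ fibre φ c ∣
  pigeonhole-⌈/⌉ d φ with averaging d (λ c → ∣ fibre φ c ∣)
  ... | c , m≤ = c , m≤d*a⇒⌈m/d⌉≤a d (subst (_≤ d * ∣ fibre φ c ∣) (∑-∣fibre∣ φ) m≤)

module Colorings where

  open import Defs
  open import Data.Fin using (Fin; zero)
  open import Data.Fin.Properties using (all?; _≟_; ¬Fin0)
  open import Data.Fin.Subset using (Subset; _∈_; ∣_∣)
  open import Data.Fin.Subset.Properties using (_∈?_)
  open import Data.List using (List; []; _∷_)
  open import Data.List.Membership.Propositional using (find; lose) renaming (_∈_ to _∈ᴸ_)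
  open import Data.List.Relation.Unary.All using (All; []; _∷_)
  open import Data.List.Relation.Unary.Any using (here; any?)
  open import Data.Product using (∃; _×_; _,_; proj₁)
  open import Data.Empty using (⊥-elim)
  open import Relation.Nullary using (¬_; Dec; yes; no; _→-dec_)
  open import Relation.Binary.PropositionalEquality using (_≡_; refl)
  open FiniteSubsets

  Mono? : ∀ {n k} (c : Fin n → Fin k) e → Dec (Mono c e)
  Mono? c e = all? λ u → all? λ v → (u ∈? e) →-dec ((v ∈? e) →-dec (c u ≟ c v))

  monochromatic-edge : ∀ {n k} {es : List (Subset n)} → ¬ ColorableEdges n es k →
                       (c : Fin n → Fin k) → ∃ λ e → e ∈ᴸ es × Mono c e
  monochromatic-edge {es = es} ¬colorable c with any? (Mono? c) es
  ... | yes mono = find mono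
  ... | no ¬mono = ⊥-elim (¬colorable (c , λ e e∈ mono → ¬mono (lose e∈ mono)))

  0-uniform⇒1-colorable : ∀ {k} (H : Hypergraph 0) → Colorable H k → Colorable H 1
  0-uniform⇒1-colorable H (c , proper) = (λ _ → zero) , no-edges (edges H) (uniform H) proper
    where
    no-edges : ∀ {n k} (es : List (Subset n)) → All (λ e → ∣ e ∣ ≡ 0) es → {c : Fin n → Fin k} →
               ProperFor c es → ProperFor (λ _ → zero) es
    no-edges []       _             proper e ()
    no-edges (e ∷ es) (∣e∣≡0 ∷ _) proper = ⊥-elim (proper e (here refl) λ u _ u∈e _ →
      ⊥-elim (¬Fin0 (proj₁ (Enumeration.surjective (enumeration e ∣e∣≡0) u∈e))))

module NatToRational where

  open import Defs using (ℕtoℚ; _^ℚ_)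
  open import Data.Nat using (zero; suc)
  import Data.Nat as ℕ
  open import Data.Integer using (+_)
  open import Data.Rational using (1ℚ; _*_; _+_; toℚᵘ)
  open import Data.Rational.Properties using
    ( normalize-coprime; toℚᵘ-injective; toℚᵘ-homo-+
    ; +-identityˡ; +-assoc; *-identityˡ; *-zeroˡ; *-distribʳ-+ )
  import Data.Rational.Unnormalised as ℚᵘ
  import Data.Rational.Unnormalised.Properties as ℚᵘ
  open import Data.Nat.Coprimality using (1-coprimeTo; sym)
  import Data.Integer.Solver as ℤ
  open import Relation.Binary.PropositionalEquality using (_≡_; refl; cong; cong₂; module ≡-Reasoning)
  import Relation.Binary.PropositionalEquality as ≡

  toℚᵘ-ℕtoℚ : ∀ k → toℚᵘ (ℕtoℚ k) ≡ ℚᵘ.mkℚᵘ (+ k) 0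
  toℚᵘ-ℕtoℚ k = cong toℚᵘ (normalize-coprime (sym (1-coprimeTo k)))

  ℕtoℚ-suc : ∀ k → ℕtoℚ (suc k) ≡ 1ℚ + ℕtoℚ k
  ℕtoℚ-suc k = toℚᵘ-injective (begin-equality
    toℚᵘ (ℕtoℚ (suc k))            ≡⟨ toℚᵘ-ℕtoℚ (suc k) ⟩
    ℚᵘ.mkℚᵘ (+ suc k) 0            ≃⟨ ℚᵘ.*≡* cross-multiplied ⟩
    toℚᵘ 1ℚ ℚᵘ.+ ℚᵘ.mkℚᵘ (+ k) 0    ≡⟨ cong (toℚᵘ 1ℚ ℚᵘ.+_) (toℚᵘ-ℕtoℚ k) ⟨
    toℚᵘ 1ℚ ℚᵘ.+ toℚᵘ (ℕtoℚ k)      ≃⟨ toℚᵘ-homo-+ 1ℚ (ℕtoℚ k) ⟨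
    toℚᵘ (1ℚ + ℕtoℚ k)             ∎)
    where
    open ℚᵘ.≤-Reasoning
    open ℤ.+-*-Solver
    cross-multiplied = solve 1 (λ k → (con (+ 1) :+ k) :* con (+ 1)
                                   := (con (+ 1) :* con (+ 1) :+ k :* con (+ 1)) :* con (+ 1)) refl (+ k)

  ℕtoℚ-+ : ∀ a b → ℕtoℚ (a ℕ.+ b) ≡ ℕtoℚ a + ℕtoℚ b
  ℕtoℚ-+ zero    b = ≡.sym (+-identityˡ (ℕtoℚ b))
  ℕtoℚ-+ (suc a) b = begin
    ℕtoℚ (suc (a ℕ.+ b))         ≡⟨ ℕtoℚ-suc (a ℕ.+ b) ⟩
    1ℚ + ℕtoℚ (a ℕ.+ b)          ≡⟨ cong (λ x → 1ℚ + x) (ℕtoℚ-+ a b) ⟩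
    1ℚ + (ℕtoℚ a + ℕtoℚ b)       ≡⟨ +-assoc 1ℚ (ℕtoℚ a) (ℕtoℚ b) ⟨
    (1ℚ + ℕtoℚ a) + ℕtoℚ b       ≡⟨ cong (_+ ℕtoℚ b) (ℕtoℚ-suc a) ⟨
    ℕtoℚ (suc a) + ℕtoℚ b        ∎
    where open ≡-Reasoning

  ℕtoℚ-* : ∀ a b → ℕtoℚ (a ℕ.* b) ≡ ℕtoℚ a * ℕtoℚ b
  ℕtoℚ-* zero    b = ≡.sym (*-zeroˡ (ℕtoℚ b))
  ℕtoℚ-* (suc a) b = begin
    ℕtoℚ (b ℕ.+ a ℕ.* b)             ≡⟨ ℕtoℚ-+ b (a ℕ.* b) ⟩
    ℕtoℚ b + ℕtoℚ (a ℕ.* b)          ≡⟨ cong₂ _+_ (≡.sym (*-identityˡ (ℕtoℚ b))) (ℕtoℚ-* a b) ⟩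
    1ℚ * ℕtoℚ b + ℕtoℚ a * ℕtoℚ b    ≡⟨ *-distribʳ-+ (ℕtoℚ b) 1ℚ (ℕtoℚ a) ⟨
    (1ℚ + ℕtoℚ a) * ℕtoℚ b           ≡⟨ cong (_* ℕtoℚ b) (ℕtoℚ-suc a) ⟨
    ℕtoℚ (suc a) * ℕtoℚ b            ∎
    where open ≡-Reasoning

  ℕtoℚ-^ : ∀ a r → ℕtoℚ (a ℕ.^ r) ≡ ℕtoℚ a ^ℚ r
  ℕtoℚ-^ a zero    = refl
  ℕtoℚ-^ a (suc r) = ≡.trans (ℕtoℚ-* a (a ℕ.^ r)) (cong (ℕtoℚ a *_) (ℕtoℚ-^ a r))

open import Data.Rational using (ℚ; 0ℚ; 1ℚ; _≤_)
module KeptEdges (p : ℚ) (0≤p : 0ℚ ≤ p) (p≤1 : p ≤ 1ℚ) where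

  open import Defs using (probKept; ℕtoℚ; _^ℚ_)
  open import Data.Nat using (ℕ; zero; suc; z≤n; s≤s)
  import Data.Nat as ℕ
  open import Data.Bool using (if_then_else_)
  open import Data.List using (List; []; _∷_; length; filter)
  open import Data.List.Membership.Propositional using (_∈_; _∉_)
  open import Data.List.Membership.Propositional.Properties using (∈-filter⁺)
  import Data.List.Membership.DecPropositional as DecMembership
  open import Data.List.Relation.Binary.Subset.Propositional using (_⊆_)
  open import Data.List.Relation.Unary.All as All using (All; []; all?)
  open import Data.List.Relation.Unary.Any using (Any; here; there; any?)
  open import Data.List.Relation.Unary.Unique.Propositional using (Unique)
  open import Data.Rational using (_*_; _+_; _-_; -_; nonNegative)
  open import Data.Rational.Properties
  open import Data.Rational.Solver using (module +-*-Solver)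
  open import Data.Sum using (_⊎_; inj₁; inj₂)
  open import Data.Empty using (⊥-elim)
  open import Function using (_∘_; _⇔_; mk⇔; Equivalence; case_of_)
  open import Relation.Nullary using (¬_; Dec; yes; no; does; ¬?)
  open import Relation.Binary.Definitions using (DecidableEquality)
  open import Relation.Binary.PropositionalEquality
    using (_≡_; refl; sym; trans; cong; cong₂; module ≡-Reasoning)
  open UniqueLists
  open NatToRational

  0≤1-p : 0ℚ ≤ 1ℚ - p
  0≤1-p = ≤-trans (≤-reflexive (sym (+-inverseʳ p))) (+-monoˡ-≤ (- p) p≤1)

  1-p≤1 : 1ℚ - p ≤ 1ℚ
  1-p≤1 = ≤-trans (+-monoʳ-≤ 1ℚ (neg-antimono-≤ 0≤p)) (≤-reflexive (+-identityʳ 1ℚ))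

  *-monoˡ-≤-0≤ : ∀ {a x y} → 0ℚ ≤ a → x ≤ y → a * x ≤ a * y
  *-monoˡ-≤-0≤ {a} 0≤a = *-monoˡ-≤-nonNeg a {{nonNegative 0≤a}}

  ^ℚ≤1 : ∀ {x} → 0ℚ ≤ x → x ≤ 1ℚ → ∀ a → x ^ℚ a ≤ 1ℚ
  ^ℚ≤1 0≤x x≤1 zero    = ≤-refl
  ^ℚ≤1 {x} 0≤x x≤1 (suc a) =
    ≤-trans (*-monoˡ-≤-0≤ 0≤x (^ℚ≤1 0≤x x≤1 a)) (≤-trans (≤-reflexive (*-identityʳ x)) x≤1)

  ^ℚ-antitone : ∀ {x} → 0ℚ ≤ x → x ≤ 1ℚ → ∀ {a b} → a ℕ.≤ b → x ^ℚ b ≤ x ^ℚ a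
  ^ℚ-antitone 0≤x x≤1 {b = b} z≤n     = ^ℚ≤1 0≤x x≤1 b
  ^ℚ-antitone 0≤x x≤1         (s≤s a≤b) = *-monoˡ-≤-0≤ 0≤x (^ℚ-antitone 0≤x x≤1 a≤b)

  𝟙 : ∀ {A : Set} → Dec A → ℚ
  𝟙 A? = if does A? then 1ℚ else 0ℚ

  0≤𝟙 : ∀ {A : Set} (A? : Dec A) → 0ℚ ≤ 𝟙 A?
  0≤𝟙 (yes _) = nonNegative⁻¹ 1ℚ
  0≤𝟙 (no _)  = ≤-refl

  𝟙-yes : ∀ {A : Set} (A? : Dec A) → A → 𝟙 A? ≡ 1ℚ
  𝟙-yes (yes _) _ = refl
  𝟙-yes (no ¬a) a = ⊥-elim (¬a a)

  𝟙-no : ∀ {A : Set} (A? : Dec A) → ¬ A → 𝟙 A? ≡ 0ℚ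
  𝟙-no (yes a) ¬a = ⊥-elim (¬a a)
  𝟙-no (no _)  _  = refl

  𝟙-cong : ∀ {A B : Set} (A? : Dec A) (B? : Dec B) → A ⇔ B → 𝟙 A? ≡ 𝟙 B?
  𝟙-cong (yes a) B? A⇔B = sym (𝟙-yes B? (Equivalence.to A⇔B a))
  𝟙-cong (no ¬a) B? A⇔B = sym (𝟙-no B? (λ b → ¬a (Equivalence.from A⇔B b)))

  𝟙-⊎ : ∀ {A B C : Set} (A? : Dec A) (B? : Dec B) (C? : Dec C) → (A → B ⊎ C) → 𝟙 A? ≤ 𝟙 B? + 𝟙 C?
  𝟙-⊎ (no _)  B? C? _ = ≤-trans (≤-reflexive (sym (+-identityʳ 0ℚ))) (+-mono-≤ (0≤𝟙 B?) (0≤𝟙 C?))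
  𝟙-⊎ (yes a) B? C? A⇒B⊎C with A⇒B⊎C a
  ... | inj₁ b = ≤-trans (≤-reflexive (trans (sym (+-identityʳ 1ℚ)) (cong (_+ 0ℚ) (sym (𝟙-yes B? b)))))
                         (+-monoʳ-≤ (𝟙 B?) (0≤𝟙 C?))
  ... | inj₂ c = ≤-trans (≤-reflexive (trans (sym (+-identityˡ 1ℚ)) (cong (0ℚ +_) (sym (𝟙-yes C? c)))))
                         (+-monoˡ-≤ (𝟙 C?) (0≤𝟙 B?))

  module _ {A : Set} where

    probKept-⊎ : ∀ {P Q R : List A → Set}
                 (P? : ∀ S → Dec (P S)) (Q? : ∀ S → Dec (Q S)) (R? : ∀ S → Dec (R S)) →
                 (∀ S → P S → Q S ⊎ R S) → ∀ kept es →
                 probKept p P? kept es ≤ probKept p Q? kept es + probKept p R? kept es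
    probKept-⊎ P? Q? R? P⇒Q⊎R kept []       = 𝟙-⊎ (P? kept) (Q? kept) (R? kept) (P⇒Q⊎R kept)
    probKept-⊎ P? Q? R? P⇒Q⊎R kept (e ∷ es) = ≤-trans
      (+-mono-≤ (*-monoˡ-≤-0≤ 0≤p    (probKept-⊎ P? Q? R? P⇒Q⊎R (e ∷ kept) es))
                (*-monoˡ-≤-0≤ 0≤1-p (probKept-⊎ P? Q? R? P⇒Q⊎R kept es)))
      (≤-reflexive (regroup p (1ℚ - p) _ _ _ _))
      where
      regroup : ∀ p q a₁ a₂ b₁ b₂ →
                p * (a₁ + a₂) + q * (b₁ + b₂) ≡ (p * a₁ + q * b₁) + (p * a₂ + q * b₂)
      regroup = solve 6 (λ p q a₁ a₂ b₁ b₂ →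
        p :* (a₁ :+ a₂) :+ q :* (b₁ :+ b₂) := (p :* a₁ :+ q :* b₁) :+ (p :* a₂ :+ q :* b₂)) refl
        where open +-*-Solver

    probKept-impossible : ∀ {Q : List A → Set} (Q? : ∀ S → Dec (Q S)) → (∀ S → ¬ Q S) →
                          ∀ kept es → probKept p Q? kept es ≡ 0ℚ
    probKept-impossible Q? ¬Q kept []       = 𝟙-no (Q? kept) (¬Q kept)
    probKept-impossible Q? ¬Q kept (e ∷ es) = begin
      p * probKept p Q? (e ∷ kept) es + (1ℚ - p) * probKept p Q? kept es
        ≡⟨ cong₂ (λ x y → p * x + (1ℚ - p) * y)
                 (probKept-impossible Q? ¬Q (e ∷ kept) es) (probKept-impossible Q? ¬Q kept es) ⟩
      p * 0ℚ + (1ℚ - p) * 0ℚ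
        ≡⟨ cong₂ _+_ (*-zeroʳ p) (*-zeroʳ (1ℚ - p)) ⟩
      0ℚ + 0ℚ
        ≡⟨ +-identityʳ 0ℚ ⟩
      0ℚ ∎
      where open ≡-Reasoning

    union-bound : ∀ {C : Set} {P : List A → Set} {Q : C → List A → Set} {B}
      (P? : ∀ S → Dec (P S)) (Q? : ∀ c S → Dec (Q c S)) (cs : List C) →
      (∀ S → P S → Any (λ c → Q c S) cs) → ∀ kept es →
      (∀ {c} → c ∈ cs → probKept p (Q? c) kept es ≤ B) →
      probKept p P? kept es ≤ ℕtoℚ (length cs) * B
    union-bound {B = B} P? Q? [] P⇒Q kept es _ = ≤-reflexive (begin
      probKept p P? kept es  ≡⟨ probKept-impossible P? (λ S PS → case P⇒Q S PS of λ ()) kept es ⟩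
      0ℚ                     ≡⟨ *-zeroˡ B ⟨
      0ℚ * B                 ∎)
      where open ≡-Reasoning
    union-bound {Q = Q} {B} P? Q? (c ∷ cs) P⇒Q kept es Q≤B = begin
      probKept p P? kept es
        ≤⟨ probKept-⊎ P? (Q? c) any-of-cs? split kept es ⟩
      probKept p (Q? c) kept es + probKept p any-of-cs? kept es
        ≤⟨ +-mono-≤ (Q≤B (here refl)) (union-bound any-of-cs? Q? cs (λ _ Q → Q) kept es (Q≤B ∘ there)) ⟩
      B + ℕtoℚ (length cs) * B
        ≡⟨ cong (_+ ℕtoℚ (length cs) * B) (*-identityˡ B) ⟨
      1ℚ * B + ℕtoℚ (length cs) * B
        ≡⟨ *-distribʳ-+ B 1ℚ (ℕtoℚ (length cs)) ⟨
      (1ℚ + ℕtoℚ (length cs)) * B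
        ≡⟨ cong (_* B) (ℕtoℚ-suc (length cs)) ⟨
      ℕtoℚ (length (c ∷ cs)) * B ∎
      where
      open ≤-Reasoning
      any-of-cs? : ∀ S → Dec (Any (λ c → Q c S) cs)
      any-of-cs? S = any? (λ c → Q? c S) cs
      split : ∀ S → _ → Q c S ⊎ Any (λ c → Q c S) cs
      split S PS with P⇒Q S PS
      ... | here Qc  = inj₁ Qc
      ... | there Qcs = inj₂ Qcs

  module _ {A : Set} (_≟_ : DecidableEquality A) where

    open DecMembership _≟_ using (_∈?_)

    Avoids : List A → List A → Set
    Avoids L S = All (_∉ S) L

    avoids? : ∀ L S → Dec (Avoids L S)
    avoids? L S = all? (λ x → ¬? (x ∈? S)) L

    probKept-avoids : ∀ L kept es →
      probKept p (avoids? L) kept es ≡ 𝟙 (avoids? L kept) * (1ℚ - p) ^ℚ length (filter (_∈? L) es)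
    probKept-avoids L kept []       = sym (*-identityʳ _)
    probKept-avoids L kept (e ∷ es) with e ∈? L
    ... | yes e∈L = begin
      p * probKept p (avoids? L) (e ∷ kept) es + (1ℚ - p) * probKept p (avoids? L) kept es
        ≡⟨ cong₂ (λ x y → p * x + (1ℚ - p) * y) (probKept-avoids L (e ∷ kept) es) (probKept-avoids L kept es) ⟩
      p * (𝟙 (avoids? L (e ∷ kept)) * qⁿ) + (1ℚ - p) * (𝟙 (avoids? L kept) * qⁿ)
        ≡⟨ cong (λ x → p * (x * qⁿ) + (1ℚ - p) * (𝟙 (avoids? L kept) * qⁿ))
                (𝟙-no (avoids? L (e ∷ kept)) (λ avoids → All.lookup avoids e∈L (here refl))) ⟩
      p * (0ℚ * qⁿ) + (1ℚ - p) * (𝟙 (avoids? L kept) * qⁿ)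
        ≡⟨ solve 3 (λ p b x → p :* (con 0ℚ :* x) :+ (con 1ℚ :- p) :* (b :* x)
                           := b :* ((con 1ℚ :- p) :* x)) refl p (𝟙 (avoids? L kept)) qⁿ ⟩
      𝟙 (avoids? L kept) * ((1ℚ - p) * qⁿ) ∎
      where
      open ≡-Reasoning
      open +-*-Solver
      qⁿ = (1ℚ - p) ^ℚ length (filter (_∈? L) es)
    ... | no e∉L = begin
      p * probKept p (avoids? L) (e ∷ kept) es + (1ℚ - p) * probKept p (avoids? L) kept es
        ≡⟨ cong₂ (λ x y → p * x + (1ℚ - p) * y) (probKept-avoids L (e ∷ kept) es) (probKept-avoids L kept es) ⟩
      p * (𝟙 (avoids? L (e ∷ kept)) * qⁿ) + (1ℚ - p) * (𝟙 (avoids? L kept) * qⁿ)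
        ≡⟨ cong (λ x → p * (x * qⁿ) + (1ℚ - p) * (𝟙 (avoids? L kept) * qⁿ))
                (𝟙-cong (avoids? L (e ∷ kept)) (avoids? L kept) keeping-e-irrelevant) ⟩
      p * (𝟙 (avoids? L kept) * qⁿ) + (1ℚ - p) * (𝟙 (avoids? L kept) * qⁿ)
        ≡⟨ solve 2 (λ p x → p :* x :+ (con 1ℚ :- p) :* x := x) refl p (𝟙 (avoids? L kept) * qⁿ) ⟩
      𝟙 (avoids? L kept) * qⁿ ∎
      where
      open ≡-Reasoning
      open +-*-Solver
      qⁿ = (1ℚ - p) ^ℚ length (filter (_∈? L) es)
      keeping-e-irrelevant : Avoids L (e ∷ kept) ⇔ Avoids L kept
      keeping-e-irrelevant = mk⇔
        (All.map (λ x∉e∷kept x∈kept → x∉e∷kept (there x∈kept)))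
        (λ avoids → All.tabulate λ x∈L → λ
          { (here refl)    → e∉L x∈L
          ; (there x∈kept) → All.lookup avoids x∈L x∈kept
          })

    probKept-avoids-≤ : ∀ {L es} → Unique L → L ⊆ es →
                        probKept p (avoids? L) [] es ≤ (1ℚ - p) ^ℚ length L
    probKept-avoids-≤ {L} {es} L! L⊆es = begin
      probKept p (avoids? L) [] es  ≡⟨ probKept-avoids L [] es ⟩
      𝟙 (avoids? L []) * qⁿ        ≡⟨ cong (_* qⁿ) (𝟙-yes (avoids? L []) (All.tabulate λ _ ())) ⟩
      1ℚ * qⁿ                      ≡⟨ *-identityˡ qⁿ ⟩
      qⁿ                           ≤⟨ ^ℚ-antitone 0≤1-p 1-p≤1 (Unique-⊆⇒length≤ L! L⊆hits) ⟩
      (1ℚ - p) ^ℚ length L         ∎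
      where
      open ≤-Reasoning
      qⁿ = (1ℚ - p) ^ℚ length (filter (_∈? L) es)
      L⊆hits : L ⊆ filter (_∈? L) es
      L⊆hits x∈L = ∈-filter⁺ (_∈? L) (L⊆es x∈L) x∈L

open import Defs using (Hypergraph; InA)
open import Data.Nat using (ℕ; suc)

-- The uniformity is suc r so that an edge has a vertex: its index a zero serves as the default
-- when a choice of indices on an edge is extended to all vertices of H.
module BlowUp {r : ℕ} (H G : Hypergraph (suc r)) (m : ℕ) (blow-up : InA H m G) where

  open import Defs
  open import Data.Nat using (zero; NonZero; _^_)
  import Data.Nat as ℕ
  open import Data.Bool.Properties as Bool using ()
  open import Data.Rational using (ℚ; 0ℚ; 1ℚ; _<_; _≤_; _*_; _-_)
  import Data.Rational.Properties as ℚ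
  open import Data.Nat.Combinatorics using (_C_)
  open import Data.Fin using (Fin; zero; suc)
  open import Data.Fin.Properties using (_≟_)
  open import Data.Fin.Subset using (Subset; _∈_; _⊆_; ∣_∣; ⊤)
  open import Data.Fin.Subset.Properties using (∈⊤)
  open import Data.Vec using (Vec; lookup; tabulate)
  open import Data.Vec.Properties using (lookup∘tabulate; ≡-dec)
  open import Data.List using (List; []; length; map; cartesianProduct)
  open import Data.List.Properties using (length-map)
  open import Data.List.Membership.Propositional using (mapWith∈; lose) renaming (_∈_ to _∈ᴸ_)
  open import Data.List.Membership.Propositional.Properties
    using (∈-map⁻; ∈-cartesianProduct⁺; ∈-cartesianProduct⁻)
  import Data.List.Membership.Setoid.Properties as Setoid
  open import Data.List.Relation.Binary.Subset.Propositional using () renaming (_⊆_ to _⊆ᴸ_)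
  import Data.List.Relation.Unary.All as All
  open import Data.List.Relation.Unary.Any using (Any)
  import Data.List.Relation.Unary.Any.Properties as Any
  open import Data.List.Relation.Unary.Unique.Propositional using (Unique)
  import Data.List.Relation.Unary.Unique.Propositional.Properties as Unique
  open import Data.Product using (Σ; ∃; _×_; _,_; proj₁; proj₂)
  open import Data.Empty using (⊥; ⊥-elim)
  open import Function using (_∘_; _⇔_; mk⇔; Equivalence)
  open import Function.Definitions using (Injective)
  open import Relation.Nullary using (¬_; Dec; yes; no)
  open import Relation.Binary.Definitions using (DecidableEquality)
  open import Relation.Binary.PropositionalEquality
    using (_≡_; _≢_; _≗_; refl; sym; trans; cong; cong₂; subst; setoid; module ≡-Reasoning)
  open Choices
  open FiniteSubsets
  open Fibres
  open Colorings
  open FinFunctions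
  open NatToRational

  f : Fin (n H) → Fin m → Fin (n G)
  f = proj₁ blow-up

  f-injective : ∀ v → Injective _≡_ _≡_ (f v)
  f-injective v {i} {j} fvi≡fvj with i ≟ j
  ... | yes i≡j = i≡j
  ... | no  i≢j = ⊥-elim (proj₁ (proj₂ blow-up) v i j i≢j fvi≡fvj)

  module _ {e} (e∈E : e ∈ᴸ edges H) where

    private
      module Vertices = Enumeration (enumeration e (All.lookup (uniform H) e∈E))

    vertex : Fin (suc r) → Fin (n H)
    vertex = Vertices.at

    f-separates : ∀ {i j} → i ≢ j → ∀ a b → f (vertex i) a ≢ f (vertex j) b
    f-separates {i} {j} i≢j a b f[i,a]≡f[j,b] with two-point (i≢j ∘ Vertices.injective) a b
    ... | g , g[i]≡a , g[j]≡b = proj₁ (proj₂ (proj₂ blow-up)) e e∈E g (vertex i) (vertex j)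
          (Vertices.at∈ i) (Vertices.at∈ j) (i≢j ∘ Vertices.injective) (begin
            f (vertex i) (g (vertex i))  ≡⟨ cong (f (vertex i)) g[i]≡a ⟩
            f (vertex i) a               ≡⟨ f[i,a]≡f[j,b] ⟩
            f (vertex j) b               ≡⟨ cong (f (vertex j)) g[j]≡b ⟨
            f (vertex j) (g (vertex j))  ∎)
      where open ≡-Reasoning

    lifted : (Fin (suc r) → Fin m) → Fin (suc r) → Fin (n G)
    lifted a j = f (vertex j) (a j)

    transversal : (Fin (suc r) → Fin m) → Subset (n G)
    transversal a = image (lifted a) ⊤

    transversal-∈-edges : ∀ a → transversal a ∈ᴸ edges G
    transversal-∈-edges a with extend Vertices.injective (a zero) a
    ... | g , g∘vertex≡a =
      Equivalence.from (proj₂ (proj₂ (proj₂ (proj₂ blow-up))) (transversal a)) (e , e∈E , g , is-image)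
      where
      is-image : IsImage (λ v → f v (g v)) e (transversal a)
      is-image x = mk⇔
        (λ x∈ → let j , _ , f[j,a[j]]≡x = ∈-image⁻ (lifted a) x∈ in
          vertex j , Vertices.at∈ j , trans (cong (f (vertex j)) (g∘vertex≡a j)) f[j,a[j]]≡x)
        (λ (v , v∈e , f[v,g[v]]≡x) → let j , vertex[j]≡v = Vertices.surjective v∈e in
          subst (_∈ transversal a)
                (trans (cong (λ v → f v (g v)) vertex[j]≡v) f[v,g[v]]≡x)
                (subst (λ y → f (vertex j) y ∈ transversal a) (sym (g∘vertex≡a j)) (∈-image⁺ (lifted a) ∈⊤)))

    transversal-injective : ∀ {a b} → transversal a ≡ transversal b → a ≗ b
    transversal-injective {a} {b} T[a]≡T[b] j
      with ∈-image⁻ (lifted b) (subst (lifted a j ∈_) T[a]≡T[b] (∈-image⁺ (lifted a) ∈⊤))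
    ... | j′ , _ , f[j′,b]≡f[j,a] with j′ ≟ j
    ...   | yes refl = sym (f-injective (vertex j) f[j′,b]≡f[j,a])
    ...   | no  j′≢j = ⊥-elim (f-separates j′≢j (b j′) (a j) f[j′,b]≡f[j,a])

    vertex∈e : ∀ j → vertex j ∈ e
    vertex∈e = Vertices.at∈

  Copy : Set
  Copy = (∃ λ e → e ∈ᴸ edges H) × Vec (Subset m) (suc r)

  copyEdges : Copy → List (Subset (n G))
  copyEdges ((_ , e∈E) , parts) = map (transversal e∈E ∘ lookup) (choices (elements ∘ lookup parts))

  copyEdges-Unique : ∀ cp → Unique (copyEdges cp)
  copyEdges-Unique ((_ , e∈E) , parts) =
    Unique.map⁺ (lookup-injective ∘ transversal-injective e∈E) (choices-Unique _ (elements-Unique ∘ lookup parts))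

  copyEdges-⊆ : ∀ cp → copyEdges cp ⊆ᴸ edges G
  copyEdges-⊆ ((_ , e∈E) , parts) S∈ with ∈-map⁻ (transversal e∈E ∘ lookup) S∈
  ... | a , _ , refl = transversal-∈-edges e∈E (lookup a)

  length-copyEdges : ∀ {k} cp → (∀ j → ∣ lookup (proj₂ cp) j ∣ ≡ k) → length (copyEdges cp) ≡ k ^ suc r
  length-copyEdges ((_ , e∈E) , parts) ∣parts∣≡k =
    trans (length-map (transversal e∈E ∘ lookup) (choices (elements ∘ lookup parts)))
          (length-choices (elements ∘ lookup parts) λ j →
             trans (length-elements (lookup parts j)) (∣parts∣≡k j))

  edgesWith∈ : List (∃ λ e → e ∈ᴸ edges H)
  edgesWith∈ = mapWith∈ (edges H) (λ {e} e∈E → e , e∈E)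

  partsOfSize : ℕ → List (Vec (Subset m) (suc r))
  partsOfSize k = choices (λ _ → subsetsOfSize m k)

  copies : ℕ → List Copy
  copies k = cartesianProduct edgesWith∈ (partsOfSize k)

  length-copies : ∀ k → length (copies k) ≡ length (edges H) ℕ.* (m C k) ^ suc r
  length-copies k = trans (length-cartesianProductWith _,_ edgesWith∈ (partsOfSize k))
    (cong₂ ℕ._*_ (Setoid.length-mapWith∈ (setoid _) (edges H))
               (length-choices (λ _ → subsetsOfSize m k) (λ _ → length-subsetsOfSize m k)))

  ∈-copies⁺ : ∀ {k e} (e∈E : e ∈ᴸ edges H) {parts} → (∀ j → ∣ lookup parts j ∣ ≡ k) →
              ((e , e∈E) , parts) ∈ᴸ copies k
  ∈-copies⁺ e∈E ∣parts∣≡k = ∈-cartesianProduct⁺ (Any.mapWith∈⁺ _ (_ , e∈E , refl))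
    (∈-choices⁺ _ (λ j → ∈-subsetsOfSize⁺ m _ (∣parts∣≡k j)))

  ∈-copies⁻ : ∀ {k cp} → cp ∈ᴸ copies k → ∀ j → ∣ lookup (proj₂ cp) j ∣ ≡ k
  ∈-copies⁻ {k} cp∈ j =
    ∈-subsetsOfSize⁻ m k (∈-choices⁻ _ (proj₂ (∈-cartesianProduct⁻ edgesWith∈ (partsOfSize k) cp∈)) j)

  record MonochromaticCopy {d} (c : Fin (n G) → Fin d) (k : ℕ) : Set where
    field
      edge          : Subset (n H)
      edge∈E        : edge ∈ᴸ edges H
      parts         : Vec (Subset m) (suc r)
      ∣parts∣≡k      : ∀ j → ∣ lookup parts j ∣ ≡ k
      color         : Fin d
      monochromatic : ∀ j {i} → i ∈ lookup parts j → c (f (vertex edge∈E j) i) ≡ color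

    copy : Copy
    copy = (edge , edge∈E) , parts

    copyEdges-Mono : ∀ {S} → S ∈ᴸ copyEdges copy → Mono c S
    copyEdges-Mono S∈ with ∈-map⁻ (transversal edge∈E ∘ lookup) S∈
    ... | a , a∈ , refl = λ x y x∈ y∈ → trans (has-color x∈) (sym (has-color y∈))
      where
      has-color : ∀ {x} → x ∈ transversal edge∈E (lookup a) → c x ≡ color
      has-color x∈ with ∈-image⁻ (lifted edge∈E (lookup a)) x∈
      ... | j , _ , refl = monochromatic j (∈-elements⁻ (∈-choices⁻ (elements ∘ lookup parts) a∈ j))

  module _ {d} .{{_ : NonZero d}} (c : Fin (n G) → Fin d) where

    inducedColoring : Fin (n H) → Fin d
    inducedColoring v = proj₁ (pigeonhole-⌈/⌉ d (c ∘ f v))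

    largeColorClass : ∀ v → ∃ λ s → s ⊆ fibre (c ∘ f v) (inducedColoring v) × ∣ s ∣ ≡ ⌈ m / d ⌉
    largeColorClass v = ⊆-of-size _ _ (proj₂ (pigeonhole-⌈/⌉ d (c ∘ f v)))

    monochromatic-copy : ¬ Colorable H d → MonochromaticCopy c ⌈ m / d ⌉
    monochromatic-copy ¬colorable with monochromatic-edge ¬colorable inducedColoring
    ... | e , e∈E , mono = record
      { edge          = e
      ; edge∈E        = e∈E
      ; parts         = tabulate part
      ; ∣parts∣≡k      = λ j → trans (cong ∣_∣ (lookup∘tabulate part j)) (∣part∣≡k j)
      ; color         = inducedColoring (vertex e∈E zero)
      ; monochromatic = λ j i∈ → trans (part-color j (subst (_ ∈_) (lookup∘tabulate part j) i∈))
                                       (mono _ _ (vertex∈e e∈E j) (vertex∈e e∈E zero))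
      }
      where
      part : Fin (suc r) → Subset m
      part j = proj₁ (largeColorClass (vertex e∈E j))
      ∣part∣≡k : ∀ j → ∣ part j ∣ ≡ ⌈ m / d ⌉
      ∣part∣≡k j = proj₂ (proj₂ (largeColorClass (vertex e∈E j)))
      part-color : ∀ j {i} → i ∈ part j → c (f (vertex e∈E j) i) ≡ inducedColoring (vertex e∈E j)
      part-color j = ∈-fibre⁻ (c ∘ f (vertex e∈E j)) ∘ proj₁ (proj₂ (largeColorClass (vertex e∈E j)))

  monochromatic-K[k] : ∀ {d} {c : Fin (n G) → Fin d} {k} → MonochromaticCopy c k →
    Σ (Fin (suc r) → Subset (n G)) λ W →
      (∀ i j → i ≢ j → ∀ x → x ∈ W i → x ∈ W j → ⊥)
    × (∀ j → ∣ W j ∣ ≡ k)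
    × (∀ (w : Fin (suc r) → Fin (n G)) → (∀ j → w j ∈ W j) →
         ∃ λ S → S ∈ᴸ edges G × IsImage w ⊤ S)
    × (∃ λ (col : Fin d) → ∀ j x → x ∈ W j → c x ≡ col)
  monochromatic-K[k] {c = c} {k} M = W , disjoint , ∣W∣≡k , complete , color , W-color
    where
    open MonochromaticCopy M
    W : Fin (suc r) → Subset (n G)
    W j = image (f (vertex edge∈E j)) (lookup parts j)

    disjoint : ∀ i j → i ≢ j → ∀ x → x ∈ W i → x ∈ W j → ⊥
    disjoint i j i≢j x x∈Wi x∈Wj with ∈-image⁻ (f (vertex edge∈E i)) x∈Wi | ∈-image⁻ (f (vertex edge∈E j)) x∈Wj
    ... | a , _ , f[i,a]≡x | b , _ , f[j,b]≡x = f-separates edge∈E i≢j a b (trans f[i,a]≡x (sym f[j,b]≡x))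

    ∣W∣≡k : ∀ j → ∣ W j ∣ ≡ k
    ∣W∣≡k j = trans (∣image∣≡∣s∣ (f (vertex edge∈E j)) (f-injective (vertex edge∈E j)) (lookup parts j))
                    (∣parts∣≡k j)

    complete : ∀ (w : Fin (suc r) → Fin (n G)) → (∀ j → w j ∈ W j) → ∃ λ S → S ∈ᴸ edges G × IsImage w ⊤ S
    complete w w∈W =
      transversal edge∈E a , transversal-∈-edges edge∈E a , IsImage-image (lifted edge∈E a) lifted-a≗w ⊤
      where
      a : Fin (suc r) → Fin m
      a j = proj₁ (∈-image⁻ (f (vertex edge∈E j)) (w∈W j))
      lifted-a≗w : ∀ j → lifted edge∈E a j ≡ w j
      lifted-a≗w j = proj₂ (proj₂ (∈-image⁻ (f (vertex edge∈E j)) (w∈W j)))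

    W-color : ∀ j x → x ∈ W j → c x ≡ color
    W-color j x x∈Wj with ∈-image⁻ (f (vertex edge∈E j)) x∈Wj
    ... | i , i∈ , refl = monochromatic j i∈

  probKept-colorable-≤ : ∀ {d} .{{_ : NonZero d}} → ¬ Colorable H d →
    ∀ (p : ℚ) → 0ℚ < p → p < 1ℚ →
    (dec : (S : List (Subset (n G))) → Dec (ColorableEdges (n G) S d)) →
    probKept p dec [] (edges G)
      ≤ ℕtoℚ (length (edges H)) * (ℕtoℚ (m C ⌈ m / d ⌉) ^ℚ suc r) * ((1ℚ - p) ^ℚ (⌈ m / d ⌉ ^ suc r))
  probKept-colorable-≤ {d} ¬colorable p 0<p p<1 dec = begin
    probKept p dec [] (edges G)
      ≤⟨ union-bound dec (avoids? _≟ˢ_ ∘ copyEdges) (copies k) colorable⇒avoids [] (edges G) copy-bound ⟩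
    ℕtoℚ (length (copies k)) * qᵏʳ
      ≡⟨ cong (_* qᵏʳ) number-of-copies ⟩
    ℕtoℚ (length (edges H)) * (ℕtoℚ (m C k) ^ℚ suc r) * qᵏʳ ∎
    where
    open KeptEdges p (ℚ.<⇒≤ 0<p) (ℚ.<⇒≤ p<1)
    open ℚ.≤-Reasoning
    k = ⌈ m / d ⌉
    qᵏʳ = (1ℚ - p) ^ℚ (k ^ suc r)

    _≟ˢ_ : DecidableEquality (Subset (n G))
    _≟ˢ_ = ≡-dec Bool._≟_

    colorable⇒avoids : ∀ S → ColorableEdges (n G) S d → Any (λ cp → Avoids _≟ˢ_ (copyEdges cp) S) (copies k)
    colorable⇒avoids S (c , proper) =
      lose (∈-copies⁺ edge∈E {parts} ∣parts∣≡k) (All.tabulate λ T∈ T∈S → proper _ T∈S (copyEdges-Mono T∈))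
      where open MonochromaticCopy (monochromatic-copy c ¬colorable)

    copy-bound : ∀ {cp} → cp ∈ᴸ copies k → probKept p (avoids? _≟ˢ_ (copyEdges cp)) [] (edges G) ≤ qᵏʳ
    copy-bound {cp} cp∈ =
      subst (λ t → probKept p (avoids? _≟ˢ_ (copyEdges cp)) [] (edges G) ≤ (1ℚ - p) ^ℚ t)
            (length-copyEdges cp (∈-copies⁻ cp∈))
            (probKept-avoids-≤ _≟ˢ_ (copyEdges-Unique cp) (copyEdges-⊆ cp))

    number-of-copies : ℕtoℚ (length (copies k)) ≡ ℕtoℚ (length (edges H)) * (ℕtoℚ (m C k) ^ℚ suc r)
    number-of-copies = begin-equality
      ℕtoℚ (length (copies k))                           ≡⟨ cong ℕtoℚ (length-copies k) ⟩
      ℕtoℚ (length (edges H) ℕ.* (m C k) ^ suc r)        ≡⟨ ℕtoℚ-* (length (edges H)) _ ⟩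
      ℕtoℚ (length (edges H)) * ℕtoℚ ((m C k) ^ suc r)   ≡⟨ cong (ℕtoℚ (length (edges H)) *_) (ℕtoℚ-^ (m C k) (suc r)) ⟩
      ℕtoℚ (length (edges H)) * (ℕtoℚ (m C k) ^ℚ suc r)  ∎

open import Defs
open import Data.Nat using (ℕ; NonZero; suc; _^_)
open import Data.Nat.Combinatorics using (_C_)
open import Data.Fin using (Fin)
open import Data.Fin.Subset using (Subset; _∈_; ∣_∣; ⊤)
open import Data.List using (List; []; length)
import Data.List.Membership.Propositional as LM
open import Data.Product using (Σ; ∃; _×_)
open import Data.Empty using (⊥)
open import Relation.Nullary using (Dec)
open import Relation.Binary.PropositionalEquality using (_≡_; _≢_)
open import Data.Rational using (ℚ; 0ℚ; 1ℚ; _<_; _≤_; _*_; _-_)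
open import Data.Nat using (zero; s≤s; >-nonZero⁻¹)
open import Data.Nat.Properties using (n<1+n)
open import Data.Product using (_,_; proj₁; proj₂)
open import Data.Empty using (⊥-elim)
open import Relation.Nullary using (¬_)
open Colorings using (0-uniform⇒1-colorable)

theorem2 : ∀ {r : ℕ} (H : Hypergraph r) (d : ℕ) .{{_ : NonZero d}} →
  ChromaticNumber H (suc d) →
  ∀ (m : ℕ) (G : Hypergraph r) → InA H m G →
  -- part 1: monochromatic copy of K^r[⌈m/d⌉]
  (∀ (c : Fin (n G) → Fin d) →
    Σ (Fin r → Subset (n G)) λ W →
      (∀ i j → i ≢ j → ∀ x → x ∈ W i → x ∈ W j → ⊥)
    × (∀ j → ∣ W j ∣ ≡ ⌈ m / d ⌉)
    × (∀ (w : Fin r → Fin (n G)) → (∀ j → w j ∈ W j) →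
         ∃ λ S → S LM.∈ edges G × IsImage w ⊤ S)
    × (∃ λ (col : Fin d) → ∀ j x → x ∈ W j → c x ≡ col))
  ×
  -- part 2: Pr[χ(G(p)) ≤ d] ≤ |E| (m choose ⌈m/d⌉)^r (1-p)^(⌈m/d⌉^r)
  (∀ (p : ℚ) → 0ℚ < p → p < 1ℚ →
    (dec : (S : List (Subset (n G))) → Dec (ColorableEdges (n G) S d)) →
    probKept p dec [] (edges G)
      ≤ ℕtoℚ (length (edges H)) * (ℕtoℚ (m C ⌈ m / d ⌉) ^ℚ r)
          * ((1ℚ - p) ^ℚ (⌈ m / d ⌉ ^ r)))
theorem2 {zero}  H d χ m G _ =
  ⊥-elim (proj₂ χ 1 (s≤s (>-nonZero⁻¹ d)) (0-uniform⇒1-colorable H (proj₁ χ)))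
theorem2 {suc r} H d (_ , minimal) m G blow-up =
  (λ c → monochromatic-K[k] (monochromatic-copy c ¬d-colorable)) , probKept-colorable-≤ ¬d-colorable
  where
  open BlowUp H G m blow-up
  ¬d-colorable : ¬ Colorable H d
  ¬d-colorable = minimal d (n<1+n d)
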